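{- Let $n$ and $k$ be positive integers with $n\ge k+1$. For the complete graph $K_n$, $$Sb_k(K_n)=\binom{n}{2}-\left\lfloor\frac{(n-k-1)(n-k+1)}{2}\right\rfloor.$$
   Context: $\gamma(G)$ is the domination number of $G$ (minimum size of a dominating set). For a positive integer $k$, $Sb_k(G)$ is the minimum size of a set $\mathcal{E}$ of edges of $G$ such that $\gamma(G-\mathcal{E})=\gamma(G)+k$. -}

module Defs where

open import Data.Nat using (ℕ; _+_; _≤_; _<_)
open import Data.Bool using (Bool; true; false; _∧_; _∨_; not; T)
open import Data.Fin using (Fin)
open import Data.Fin.Properties using () renaming (_≟_ to _≟ᶠ_)
open import Data.Fin.Subset using (Subset; _∈_; ∣_∣)
open import Data.List using (List; []; _∷_; length)
open import Data.Bool.Properties using (∨-comm)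
open import Data.List.Relation.Unary.All using (All)
open import Data.List.Relation.Unary.Unique.Propositional using (Unique)
open import Data.Product using (Σ; ∃; _×_; _,_)
open import Relation.Nullary.Decidable using (⌊_⌋)
open import Relation.Binary.PropositionalEquality using (_≡_; refl; cong; cong₂)

record Graph (n : ℕ) : Set where
  field
    Adj   : Fin n → Fin n → Bool
    Adj-sym    : ∀ i j → Adj i j ≡ Adj j i
    Adj-irrefl : ∀ i → Adj i i ≡ false
open Graph public

K : (n : ℕ) → Graph n
K n = record
  { Adj = λ i j → not ⌊ i ≟ᶠ j ⌋
  ; Adj-sym = symK
  ; Adj-irrefl = irrK }
  where
  open import Relation.Nullary using (yes; no)
  open import Relation.Binary.PropositionalEquality using (sym)
  symK : ∀ (i j : Fin n) → not ⌊ i ≟ᶠ j ⌋ ≡ not ⌊ j ≟ᶠ i ⌋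
  symK i j with i ≟ᶠ j | j ≟ᶠ i
  ... | yes _ | yes _ = refl
  ... | no _  | no _  = refl
  ... | yes p | no q  with q (sym p)
  ... | ()
  symK i j | no p | yes q with p (sym q)
  ... | ()
  irrK : ∀ (i : Fin n) → not ⌊ i ≟ᶠ i ⌋ ≡ false
  irrK i with i ≟ᶠ i
  ... | yes _ = refl
  ... | no p with p refl
  ... | ()

Dominating : ∀ {n} → Graph n → Subset n → Set
Dominating {n} G S = ∀ (v : Fin n) → v ∈ S ⊎' (Σ (Fin n) λ u → u ∈ S × T (Adj G u v))
  where
  open import Data.Sum using () renaming (_⊎_ to _⊎'_)

DomNum : ∀ {n} → Graph n → ℕ → Set
DomNum {n} G d =
  (Σ (Subset n) λ S → Dominating G S × ∣ S ∣ ≡ d)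
  × (∀ (S : Subset n) → Dominating G S → d ≤ ∣ S ∣)

IsEdgeSet : ∀ {n} → Graph n → List (Fin n × Fin n) → Set
IsEdgeSet G E = All (λ { (i , j) → (i Data.Fin.< j) × T (Adj G i j) }) E × Unique E
  where import Data.Fin

matches : ∀ {n} → Fin n → Fin n → Fin n × Fin n → Bool
matches i j (a , b) = (⌊ a ≟ᶠ i ⌋ ∧ ⌊ b ≟ᶠ j ⌋) ∨ (⌊ a ≟ᶠ j ⌋ ∧ ⌊ b ≟ᶠ i ⌋)

inEdges : ∀ {n} → List (Fin n × Fin n) → Fin n → Fin n → Bool
inEdges [] i j = false
inEdges (p ∷ E) i j = matches i j p ∨ inEdges E i j

matches-sym : ∀ {n} (i j : Fin n) p → matches i j p ≡ matches j i p
matches-sym i j (a , b) = ∨-comm (⌊ a ≟ᶠ i ⌋ ∧ ⌊ b ≟ᶠ j ⌋) (⌊ a ≟ᶠ j ⌋ ∧ ⌊ b ≟ᶠ i ⌋)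

inEdges-sym : ∀ {n} (E : List (Fin n × Fin n)) i j → inEdges E i j ≡ inEdges E j i
inEdges-sym [] i j = refl
inEdges-sym (p ∷ E) i j = cong₂ _∨_ (matches-sym i j p) (inEdges-sym E i j)

delete : ∀ {n} → (G : Graph n) → List (Fin n × Fin n) → Graph n
delete G E = record
  { Adj = λ i j → Adj G i j ∧ not (inEdges E i j)
  ; Adj-sym = λ i j → cong₂ _∧_ (Adj-sym G i j) (cong not (inEdges-sym E i j))
  ; Adj-irrefl = λ i → cong (_∧ not (inEdges E i i)) (Adj-irrefl G i) }

Bondage : ∀ {n} → Graph n → ℕ → List (Fin n × Fin n) → Set
Bondage G k E = IsEdgeSet G E × Σ ℕ λ d → DomNum G d × DomNum (delete G E) (d + k)

SbNum : ∀ {n} → Graph n → ℕ → ℕ → Set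
SbNum G k m =
  (Σ _ λ E → Bondage G k E × length E ≡ m)
  × (∀ E → Bondage G k E → m ≤ length E)

{-# OPTIONS --safe #-}
-- Since γ(K_n) = 1, the task is to find the fewest edges whose deletion leaves a graph of
-- domination number k + 1.
-- Lower bound: by Vizing's bound a graph on n vertices with domination number γ has at most
-- (n − γ)(n − γ + 2)/2 edges. It is proved by induction on γ: delete the closed neighbourhood of a
-- vertex v of maximum degree Δ; what remains, R, needs at least γ − 1 vertices to be dominated, and
-- every neighbour u of v has at most |R| − γ + 2 neighbours in R, for otherwise v, u and the
-- non-neighbours of u in R would form a dominating set that is too small.
-- Upper bound: keep a complete graph on a core of m = n − k + 1 vertices minus a minimum edge cover
-- (a perfect matching, plus one edge at the unmatched vertex if m is odd), and isolate the other
-- k − 1 vertices. No core vertex dominates the core but two do, so the domination number is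
-- k + 1, while ⌊m(m − 2)/2⌋ = ⌊(n − k − 1)(n − k + 1)/2⌋ edges remain.
module Submission where

open import Defs
open import Data.Nat using (ℕ; _+_; _*_; _∸_; _/_; _≤_; _≥_)
open import Data.Nat.Combinatorics using (_C_)

open import Data.Nat using (zero; suc; _%_; _<_; z≤n; s≤s; _<ᵇ_; _≡ᵇ_)
open import Data.Nat.Properties
open import Data.Nat.DivMod using (m≡m%n+[m/n]*n; m%n<n; [m+kn]%n≡m%n)
open import Data.Nat.Combinatorics using (nC1≡n; nCk+nC[k+1]≡[n+1]C[k+1])
open import Data.Nat.Tactic.RingSolver using (solve-∀)
open import Data.Bool using (Bool; true; false; _∧_; _∨_; not; T)
open import Data.Bool.Properties using (∧-zeroʳ; ∧-identityʳ; ∧-comm; ∨-comm)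
open import Data.Fin using (Fin; toℕ; fromℕ<) renaming (zero to fzero; suc to fsuc)
import Data.Fin as Fin
open import Data.Fin.Properties using (toℕ-fromℕ<) renaming (_≟_ to _≟ᶠ_)
import Data.Fin.Properties as Fin
open import Data.Fin.Subset using (Subset; ∣_∣) renaming (_∈_ to _∈ₛ_)
open import Data.Vec using ([]; _∷_; lookup; tabulate)
open import Data.Vec.Properties using (lookup∘tabulate; []=⇒lookup; lookup⇒[]=)
open import Data.List using (List; []; _∷_; length; filter; cartesianProduct; allFin)
open import Data.List.Membership.Propositional using () renaming (_∈_ to _∈ₗ_)
open import Data.List.Membership.Propositional.Properties using (∈-filter⁺; ∈-filter⁻; ∈-cartesianProduct⁺; ∈-allFin)
open import Data.List.Relation.Unary.Any using (here; there)
open import Data.List.Relation.Unary.All using (All; []; _∷_)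
import Data.List.Relation.Unary.All as All
open import Data.List.Relation.Unary.All.Properties using (all-filter)
open import Data.List.Relation.Unary.AllPairs using ([]; _∷_)
open import Data.List.Relation.Unary.Unique.Propositional using (Unique)
open import Data.List.Relation.Unary.Unique.Propositional.Properties using (allFin⁺; cartesianProduct⁺; filter⁺)
open import Data.Sum using (_⊎_; inj₁; inj₂)
import Data.Sum as Sum
open import Data.Product using (Σ; _×_; _,_; proj₁; proj₂)
open import Data.Empty using (⊥; ⊥-elim)
open import Relation.Nullary using (yes; no; ¬_)
open import Relation.Nullary.Decidable using (Dec; ⌊_⌋; T?; _×-dec_)
open import Relation.Binary.Definitions using (tri<; tri≈; tri>)
open import Relation.Binary.PropositionalEquality
open import Algebra.Properties.Semiring.Sum +-*-semiring
  using (sum; sum-cong-≗; sum-replicate-zero; ∑-distrib-+; ∑-comm; *-distribˡ-sum)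

-- Finite sums and Iverson brackets

sum-mono-≤ : ∀ {n} {f g : Fin n → ℕ} → (∀ i → f i ≤ g i) → sum f ≤ sum g
sum-mono-≤ {zero} f≤g = z≤n
sum-mono-≤ {suc n} f≤g = +-mono-≤ (f≤g fzero) (sum-mono-≤ (λ i → f≤g (fsuc i)))

sum-const : ∀ n (c : ℕ) → sum {n} (λ _ → c) ≡ n * c
sum-const zero c = refl
sum-const (suc n) c = cong (c +_) (sum-const n c)

sum-zero : ∀ {n} {f : Fin n → ℕ} → (∀ i → f i ≡ 0) → sum f ≡ 0
sum-zero {n} f≡0 = trans (sum-cong-≗ f≡0) (sum-replicate-zero n)

term≤sum : ∀ {n} (f : Fin n → ℕ) i → f i ≤ sum f
term≤sum f fzero = m≤m+n _ _
term≤sum f (fsuc i) = ≤-trans (term≤sum (λ j → f (fsuc j)) i) (m≤n+m _ _)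

sum-*-sum : ∀ {m n} (f : Fin m → ℕ) (g : Fin n → ℕ) →
            sum (λ i → sum (λ j → f i * g j)) ≡ sum f * sum g
sum-*-sum f g = begin
  sum (λ i → sum (λ j → f i * g j)) ≡⟨ sum-cong-≗ (λ i → sym (*-distribˡ-sum (f i) g)) ⟩
  sum (λ i → f i * sum g)           ≡⟨ sum-cong-≗ (λ i → *-comm (f i) (sum g)) ⟩
  sum (λ i → sum g * f i)           ≡⟨ sym (*-distribˡ-sum (sum g) f) ⟩
  sum g * sum f                     ≡⟨ *-comm (sum g) (sum f) ⟩
  sum f * sum g                     ∎
  where open ≡-Reasoning

T-∨ˡ : ∀ {x} y → T x → T (x ∨ y)
T-∨ˡ {true} y _ = _

T-∨ʳ : ∀ x {y} → T y → T (x ∨ y)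
T-∨ʳ true _ = _
T-∨ʳ false p = p

T-∨-elim : ∀ x {y} → T (x ∨ y) → T x ⊎ T y
T-∨-elim true p = inj₁ p
T-∨-elim false p = inj₂ p

T-∧-intro : ∀ {x y} → T x → T y → T (x ∧ y)
T-∧-intro {true} _ q = q

T-∧ˡ : ∀ x {y} → T (x ∧ y) → T x
T-∧ˡ true _ = _

T-∧ʳ : ∀ x {y} → T (x ∧ y) → T y
T-∧ʳ true q = q

T-not : ∀ {x} → x ≡ false → T (not x)
T-not refl = _

T⇒≡true : ∀ {x} → T x → x ≡ true
T⇒≡true {true} _ = refl

T-not⁻¹ : ∀ {x} → T (not x) → x ≡ false
T-not⁻¹ {false} _ = refl

T-ext : ∀ {x y} → (T x → T y) → (T y → T x) → x ≡ y
T-ext {true} {true} _ _ = refl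
T-ext {true} {false} x⇒y _ = ⊥-elim (x⇒y _)
T-ext {false} {true} _ y⇒x = ⊥-elim (y⇒x _)
T-ext {false} {false} _ _ = refl

⟦_⟧ : Bool → ℕ
⟦ true ⟧ = 1
⟦ false ⟧ = 0

count : ∀ {n} → (Fin n → Bool) → ℕ
count P = sum (λ i → ⟦ P i ⟧)

⟦⟧≤1 : ∀ x → ⟦ x ⟧ ≤ 1
⟦⟧≤1 true = ≤-refl
⟦⟧≤1 false = z≤n

⟦⟧-mono : ∀ {x y} → (T x → T y) → ⟦ x ⟧ ≤ ⟦ y ⟧
⟦⟧-mono {true} {true} _ = ≤-refl
⟦⟧-mono {true} {false} x⇒y = ⊥-elim (x⇒y _)
⟦⟧-mono {false} _ = z≤n

⟦∧⟧ : ∀ x y → ⟦ x ∧ y ⟧ ≡ ⟦ x ⟧ * ⟦ y ⟧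
⟦∧⟧ true y = sym (+-identityʳ ⟦ y ⟧)
⟦∧⟧ false y = refl

⟦∨⟧≤ : ∀ x y → ⟦ x ∨ y ⟧ ≤ ⟦ x ⟧ + ⟦ y ⟧
⟦∨⟧≤ true y = s≤s z≤n
⟦∨⟧≤ false y = ≤-refl

⟦∨⟧-disjoint : ∀ x y → (T x → T y → ⊥) → ⟦ x ∨ y ⟧ ≡ ⟦ x ⟧ + ⟦ y ⟧
⟦∨⟧-disjoint true true disj = ⊥-elim (disj _ _)
⟦∨⟧-disjoint true false disj = refl
⟦∨⟧-disjoint false y disj = refl

⟦⟧+⟦not⟧ : ∀ x → ⟦ x ⟧ + ⟦ not x ⟧ ≡ 1
⟦⟧+⟦not⟧ true = refl
⟦⟧+⟦not⟧ false = refl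

count-mono : ∀ {n} {P Q : Fin n → Bool} → (∀ i → T (P i) → T (Q i)) → count P ≤ count Q
count-mono P⇒Q = sum-mono-≤ (λ i → ⟦⟧-mono (P⇒Q i))

count-∨≤ : ∀ {n} (P Q : Fin n → Bool) → count (λ i → P i ∨ Q i) ≤ count P + count Q
count-∨≤ P Q = ≤-trans (sum-mono-≤ (λ i → ⟦∨⟧≤ (P i) (Q i))) (≤-reflexive (∑-distrib-+ (λ i → ⟦ P i ⟧) (λ i → ⟦ Q i ⟧)))

count-∨-disjoint : ∀ {n} (P Q : Fin n → Bool) → (∀ i → T (P i) → T (Q i) → ⊥) →
                   count (λ i → P i ∨ Q i) ≡ count P + count Q
count-∨-disjoint P Q disj =
  trans (sum-cong-≗ (λ i → ⟦∨⟧-disjoint (P i) (Q i) (disj i))) (∑-distrib-+ (λ i → ⟦ P i ⟧) (λ i → ⟦ Q i ⟧))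

count≥1 : ∀ {n} (P : Fin n → Bool) i → T (P i) → 1 ≤ count P
count≥1 P i Pi = ≤-trans (⟦⟧-mono {true} (λ _ → Pi)) (term≤sum (λ j → ⟦ P j ⟧) i)

count-true : ∀ n → count {n} (λ _ → true) ≡ n
count-true n = trans (sum-const n 1) (*-identityʳ n)

count-not : ∀ {n} (P : Fin n → Bool) → count P + count (λ i → not (P i)) ≡ n
count-not {n} P = begin
  count P + count (λ i → not (P i))  ≡⟨ sym (∑-distrib-+ (λ i → ⟦ P i ⟧) (λ i → ⟦ not (P i) ⟧)) ⟩
  sum (λ i → ⟦ P i ⟧ + ⟦ not (P i) ⟧) ≡⟨ sum-cong-≗ (λ i → ⟦⟧+⟦not⟧ (P i)) ⟩
  count {n} (λ _ → true)             ≡⟨ count-true n ⟩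
  n                                  ∎
  where open ≡-Reasoning

count-nonempty : ∀ {n} (P : Fin n → Bool) → count P ≡ 0 ⊎ Σ (Fin n) (λ i → T (P i))
count-nonempty {zero} P = inj₁ refl
count-nonempty {suc n} P with P fzero in eq
... | true = inj₂ (fzero , subst T (sym eq) _)
... | false with count-nonempty (λ i → P (fsuc i))
...   | inj₁ none = inj₁ none
...   | inj₂ (i , Pi) = inj₂ (fsuc i , Pi)

⟦⟧-split : ∀ x y → ⟦ x ⟧ ≡ ⟦ x ∧ y ⟧ + ⟦ x ∧ not y ⟧
⟦⟧-split true true = refl
⟦⟧-split true false = refl
⟦⟧-split false y = refl

count-split : ∀ {n} (P Q : Fin n → Bool) → count P ≡ count (λ i → P i ∧ Q i) + count (λ i → P i ∧ not (Q i))
count-split P Q = trans (sum-cong-≗ (λ i → ⟦⟧-split (P i) (Q i)))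
                        (∑-distrib-+ (λ i → ⟦ P i ∧ Q i ⟧) (λ i → ⟦ P i ∧ not (Q i) ⟧))

⟦⟧*-mono : ∀ x {a b} → (T x → a ≤ b) → ⟦ x ⟧ * a ≤ ⟦ x ⟧ * b
⟦⟧*-mono true a≤b = +-monoˡ-≤ 0 (a≤b _)
⟦⟧*-mono false _ = z≤n

δ : ∀ {n} → Fin n → Fin n → Bool
δ a j = ⌊ a ≟ᶠ j ⌋

δ-suc : ∀ {n} (a j : Fin n) → δ (fsuc a) (fsuc j) ≡ δ a j
δ-suc a j with a ≟ᶠ j
... | yes _ = refl
... | no _ = refl

sum-δ : ∀ {n} (a : Fin n) (f : Fin n → ℕ) → sum (λ j → ⟦ δ a j ⟧ * f j) ≡ f a
sum-δ {suc n} fzero f = trans (cong₂ _+_ (+-identityʳ (f fzero)) (sum-zero {n} (λ _ → refl))) (+-identityʳ _)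
sum-δ (fsuc a) f =
  trans (sum-cong-≗ (λ j → cong (λ b → ⟦ b ⟧ * f (fsuc j)) (δ-suc a j))) (sum-δ a (λ j → f (fsuc j)))

count-δ : ∀ {n} (a : Fin n) → count (δ a) ≡ 1
count-δ a = trans (sum-cong-≗ (λ j → sym (*-identityʳ ⟦ δ a j ⟧))) (sum-δ a (λ _ → 1))

δ-refl : ∀ {n} (a : Fin n) → T (δ a a)
δ-refl a with a ≟ᶠ a
... | yes _ = _
... | no a≢a = a≢a refl

δ⇒≡ : ∀ {n} {a b : Fin n} → T (δ a b) → a ≡ b
δ⇒≡ {a = a} {b} p with a ≟ᶠ b
... | yes a≡b = a≡b

≢⇒δ≡false : ∀ {n} {a b : Fin n} → ¬ a ≡ b → δ a b ≡ false
≢⇒δ≡false {a = a} {b} a≢b with a ≟ᶠ b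
... | yes a≡b = ⊥-elim (a≢b a≡b)
... | no _ = refl

count-insert : ∀ {n} (a : Fin n) (P : Fin n → Bool) → count (λ i → δ a i ∨ P i) ≤ suc (count P)
count-insert a P = ≤-trans (count-∨≤ (δ a) P) (≤-reflexive (cong (_+ count P) (count-δ a)))

count-insert-disjoint : ∀ {n} (a : Fin n) (P : Fin n → Bool) → ¬ T (P a) →
                        count (λ i → δ a i ∨ P i) ≡ suc (count P)
count-insert-disjoint a P ¬Pa =
  trans (count-∨-disjoint (δ a) P (λ i a≡i Pi → ¬Pa (subst (λ x → T (P x)) (sym (δ⇒≡ a≡i)) Pi)))
        (cong (_+ count P) (count-δ a))

argmax : ∀ {n} (f : Fin (suc n) → ℕ) → Σ (Fin (suc n)) λ v → ∀ w → f w ≤ f v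
argmax {zero} f = fzero , λ { fzero → ≤-refl }
argmax {suc n} f with argmax (λ i → f (fsuc i))
... | v , v-max with f fzero ≤? f (fsuc v)
...   | yes f0≤ = fsuc v , λ { fzero → f0≤ ; (fsuc w) → v-max w }
...   | no f0≰ = fzero , λ { fzero → ≤-refl ; (fsuc w) → ≤-trans (v-max w) (≰⇒≥ f0≰) }

-- Maximise ⟦ P w ⟧ * suc (f w): the weight is positive exactly on P.
argmax-on : ∀ {n} (P : Fin n → Bool) (f : Fin n → ℕ) u → T (P u) →
            Σ (Fin n) λ v → T (P v) × (∀ w → T (P w) → f w ≤ f v)
argmax-on {suc n} P f u Pu with argmax (λ w → ⟦ P w ⟧ * suc (f w))
... | v , v-max = v , proj₁ (weight-≤ (P u) (P v) (v-max u) Pu) ,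
                  λ w Pw → proj₂ (weight-≤ (P w) (P v) (v-max w) Pw)
  where
  weight-≤ : ∀ x y {a b} → ⟦ x ⟧ * suc a ≤ ⟦ y ⟧ * suc b → T x → T y × a ≤ b
  weight-≤ true true {a} {b} le _ = _ , ≤-pred (subst₂ _≤_ (+-identityʳ (suc a)) (+-identityʳ (suc b)) le)
  weight-≤ true false ()

-- Vizing's bound

module Vizing {n : ℕ} (G : Graph n) where

  Dominates : (Fin n → Bool) → (Fin n → Bool) → Set
  Dominates D W = ∀ v → T (W v) → T (D v) ⊎ Σ (Fin n) λ u → T (D u) × T (Adj G u v)

  DominationAtLeast : ℕ → (Fin n → Bool) → Set
  DominationAtLeast g W = ∀ D → Dominates D W → g ≤ count D

  degreeIn : (Fin n → Bool) → Fin n → ℕ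
  degreeIn W u = count (λ w → W w ∧ Adj G u w)

  -- Twice the number of edges of the induced subgraph G[W].
  degreeSum : (Fin n → Bool) → ℕ
  degreeSum W = sum (λ u → ⟦ W u ⟧ * degreeIn W u)

  degreeSum≤ : ∀ (W : Fin n → Bool) → degreeSum W ≤ count W * count W
  degreeSum≤ W = begin
    degreeSum W                  ≤⟨ sum-mono-≤ (λ u → *-monoʳ-≤ ⟦ W u ⟧ degree≤) ⟩
    sum (λ u → ⟦ W u ⟧ * count W) ≡⟨ sum-cong-≗ (λ u → *-comm ⟦ W u ⟧ (count W)) ⟩
    sum (λ u → count W * ⟦ W u ⟧) ≡⟨ *-distribˡ-sum (count W) (λ u → ⟦ W u ⟧) ⟨
    count W * count W            ∎
    where
    open ≤-Reasoning
    degree≤ : ∀ {u} → degreeIn W u ≤ count W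
    degree≤ = count-mono (λ w → T-∧ˡ (W w))

  ⟦⟧*⟦∧⟧-swap : ∀ x y a → ⟦ x ⟧ * ⟦ y ∧ a ⟧ ≡ ⟦ y ⟧ * ⟦ x ∧ a ⟧
  ⟦⟧*⟦∧⟧-swap true  true  a = refl
  ⟦⟧*⟦∧⟧-swap true  false a = refl
  ⟦⟧*⟦∧⟧-swap false true  a = refl
  ⟦⟧*⟦∧⟧-swap false false a = refl

  degree-double-count : ∀ (X Y : Fin n → Bool) →
                        sum (λ u → ⟦ X u ⟧ * degreeIn Y u) ≡ sum (λ w → ⟦ Y w ⟧ * degreeIn X w)
  degree-double-count X Y = begin
    sum (λ u → ⟦ X u ⟧ * degreeIn Y u)
      ≡⟨ sum-cong-≗ (λ u → *-distribˡ-sum ⟦ X u ⟧ (λ w → ⟦ Y w ∧ Adj G u w ⟧)) ⟩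
    sum (λ u → sum (λ w → ⟦ X u ⟧ * ⟦ Y w ∧ Adj G u w ⟧))
      ≡⟨ ∑-comm (λ u w → ⟦ X u ⟧ * ⟦ Y w ∧ Adj G u w ⟧) ⟩
    sum (λ w → sum (λ u → ⟦ X u ⟧ * ⟦ Y w ∧ Adj G u w ⟧))
      ≡⟨ sum-cong-≗ (λ w → sum-cong-≗ (λ u →
           trans (⟦⟧*⟦∧⟧-swap (X u) (Y w) (Adj G u w)) (cong (λ a → ⟦ Y w ⟧ * ⟦ X u ∧ a ⟧) (Adj-sym G u w)))) ⟩
    sum (λ w → sum (λ u → ⟦ Y w ⟧ * ⟦ X u ∧ Adj G w u ⟧))
      ≡⟨ sum-cong-≗ (λ w → *-distribˡ-sum ⟦ Y w ⟧ (λ u → ⟦ X u ∧ Adj G w u ⟧)) ⟨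
    sum (λ w → ⟦ Y w ⟧ * degreeIn X w) ∎
    where open ≡-Reasoning

  degreeIn-split : ∀ (X Y : Fin n → Bool) u →
                   degreeIn X u ≡ degreeIn (λ w → X w ∧ Y w) u + degreeIn (λ w → X w ∧ not (Y w)) u
  degreeIn-split X Y u =
    trans (sum-cong-≗ (λ w → split (X w) (Y w) (Adj G u w)))
          (∑-distrib-+ (λ w → ⟦ (X w ∧ Y w) ∧ Adj G u w ⟧) (λ w → ⟦ (X w ∧ not (Y w)) ∧ Adj G u w ⟧))
    where
    split : ∀ x y a → ⟦ x ∧ a ⟧ ≡ ⟦ (x ∧ y) ∧ a ⟧ + ⟦ (x ∧ not y) ∧ a ⟧
    split true true a = sym (+-identityʳ ⟦ a ⟧)
    split true false a = refl
    split false y a = refl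

  module MaxDegreeStep (g : ℕ) (W : Fin n → Bool) (γW : DominationAtLeast (suc g) W)
                       (v : Fin n) (v∈W : T (W v))
                       (v-max : ∀ u → T (W u) → degreeIn W u ≤ degreeIn W v) where

    N⟨v⟩ N[v] R : Fin n → Bool
    N⟨v⟩ w = W w ∧ Adj G v w
    N[v] w = W w ∧ (δ v w ∨ Adj G v w)
    R w = W w ∧ not (δ v w ∨ Adj G v w)

    Δ r s : ℕ
    Δ = degreeIn W v
    r = count R
    s = r ∸ g

    ⟦N[v]⟧-split : ∀ w → ⟦ N[v] w ⟧ ≡ ⟦ δ v w ⟧ + ⟦ N⟨v⟩ w ⟧
    ⟦N[v]⟧-split w with v ≟ᶠ w
    ... | yes refl rewrite T⇒≡true v∈W | Adj-irrefl G v = refl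
    ... | no _ = refl

    count-W : count W ≡ suc (Δ + r)
    count-W = begin
      count W
        ≡⟨ count-split W (λ w → δ v w ∨ Adj G v w) ⟩
      count N[v] + r
        ≡⟨ cong (_+ r) (trans (sum-cong-≗ ⟦N[v]⟧-split) (∑-distrib-+ (λ w → ⟦ δ v w ⟧) (λ w → ⟦ N⟨v⟩ w ⟧))) ⟩
      count (δ v) + Δ + r
        ≡⟨ cong (λ c → c + Δ + r) (count-δ v) ⟩
      suc (Δ + r) ∎
      where open ≡-Reasoning

    N[v]-or-R : ∀ w → T (W w) → T (δ v w) ⊎ T (Adj G v w) ⊎ T (R w)
    N[v]-or-R w Ww with δ v w | Adj G v w
    ... | true  | _     = inj₁ _
    ... | false | true  = inj₂ (inj₁ _)
    ... | false | false = inj₂ (inj₂ (T-∧-intro Ww _))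

    dominates-W : ∀ D → Dominates D R → Dominates (λ w → δ v w ∨ D w) W
    dominates-W D D-dom w Ww with N[v]-or-R w Ww
    ... | inj₁ v≡w = inj₁ (T-∨ˡ (D w) v≡w)
    ... | inj₂ (inj₁ v~w) = inj₂ (v , T-∨ˡ (D v) (δ-refl v) , v~w)
    ... | inj₂ (inj₂ Rw) =
      Sum.map (T-∨ʳ (δ v w)) (λ { (u , Du , u~w) → u , T-∨ʳ (δ v u) Du , u~w }) (D-dom w Rw)

    γR : DominationAtLeast g R
    γR D D-dom = ≤-pred (≤-trans (γW _ (dominates-W D D-dom)) (count-insert v D))

    g≤r : g ≤ r
    g≤r = γR R (λ w Rw → inj₁ Rw)

    -- {v , u} together with the non-neighbours of u in R dominate W.
    degreeIn-R : ∀ u → degreeIn R u ≤ suc s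
    degreeIn-R u = begin
      degreeIn R u               ≤⟨ m+n≤o⇒m≤o∸n (degreeIn R u) d+g≤1+r ⟩
      suc r ∸ g                  ≡⟨ +-∸-assoc 1 g≤r ⟩
      suc s                      ∎
      where
      open ≤-Reasoning
      Ru : Fin n → Bool
      Ru w = R w ∧ not (Adj G u w)
      Ru-dominates : Dominates (λ w → δ u w ∨ Ru w) R
      Ru-dominates w Rw with Adj G u w in u~w
      ... | true  = inj₂ (u , T-∨ˡ (Ru u) (δ-refl u) , subst T (sym u~w) _)
      ... | false = inj₁ (T-∨ʳ (δ u w) (T-∧-intro Rw _))
      g≤1+Ru : g ≤ suc (count Ru)
      g≤1+Ru = ≤-trans (γR _ Ru-dominates) (count-insert u Ru)
      d+g≤1+r : degreeIn R u + g ≤ suc r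
      d+g≤1+r = begin
        degreeIn R u + g               ≤⟨ +-monoʳ-≤ (degreeIn R u) g≤1+Ru ⟩
        degreeIn R u + suc (count Ru)  ≡⟨ +-suc (degreeIn R u) (count Ru) ⟩
        suc (degreeIn R u + count Ru)  ≡⟨ cong suc (count-split R (Adj G u)) ⟨
        suc r                          ∎

    degreeIn-R-v : degreeIn R v ≡ 0
    degreeIn-R-v = sum-zero (λ w → no-edge (W w) (δ v w) (Adj G v w))
      where
      no-edge : ∀ x y a → ⟦ (x ∧ not (y ∨ a)) ∧ a ⟧ ≡ 0
      no-edge false y a = refl
      no-edge true true a = refl
      no-edge true false true = refl
      no-edge true false false = refl

    degreeSum-split : degreeSum W ≡ sum (λ u → ⟦ N[v] u ⟧ * (degreeIn W u + degreeIn R u)) + degreeSum R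
    degreeSum-split = begin
      sum (λ u → ⟦ W u ⟧ * dW u)
        ≡⟨ sum-cong-≗ (λ u → trans (cong (_* dW u) (⟦⟧-split (W u) (Y u))) (*-distribʳ-+ (dW u) ⟦ N[v] u ⟧ ⟦ R u ⟧)) ⟩
      sum (λ u → ⟦ N[v] u ⟧ * dW u + ⟦ R u ⟧ * dW u)
        ≡⟨ ∑-distrib-+ (λ u → ⟦ N[v] u ⟧ * dW u) (λ u → ⟦ R u ⟧ * dW u) ⟩
      sum (λ u → ⟦ N[v] u ⟧ * dW u) + sum (λ u → ⟦ R u ⟧ * dW u)
        ≡⟨ cong (sum (λ u → ⟦ N[v] u ⟧ * dW u) +_) R-part ⟩
      sum (λ u → ⟦ N[v] u ⟧ * dW u) + (sum (λ u → ⟦ N[v] u ⟧ * dR u) + degreeSum R)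
        ≡⟨ +-assoc (sum (λ u → ⟦ N[v] u ⟧ * dW u)) _ _ ⟨
      sum (λ u → ⟦ N[v] u ⟧ * dW u) + sum (λ u → ⟦ N[v] u ⟧ * dR u) + degreeSum R
        ≡⟨ cong (_+ degreeSum R) (trans (sum-cong-≗ (λ u → *-distribˡ-+ ⟦ N[v] u ⟧ (dW u) (dR u)))
                                         (∑-distrib-+ (λ u → ⟦ N[v] u ⟧ * dW u) (λ u → ⟦ N[v] u ⟧ * dR u))) ⟨
      sum (λ u → ⟦ N[v] u ⟧ * (dW u + dR u)) + degreeSum R ∎
      where
      open ≡-Reasoning
      Y : Fin n → Bool
      Y w = δ v w ∨ Adj G v w
      dW dR : Fin n → ℕ
      dW = degreeIn W
      dR = degreeIn R
      R-part : sum (λ u → ⟦ R u ⟧ * dW u) ≡ sum (λ u → ⟦ N[v] u ⟧ * dR u) + degreeSum R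
      R-part = begin
        sum (λ u → ⟦ R u ⟧ * dW u)
          ≡⟨ sum-cong-≗ (λ u → trans (cong (⟦ R u ⟧ *_) (degreeIn-split W Y u))
                                      (*-distribˡ-+ ⟦ R u ⟧ (degreeIn N[v] u) (dR u))) ⟩
        sum (λ u → ⟦ R u ⟧ * degreeIn N[v] u + ⟦ R u ⟧ * dR u)
          ≡⟨ ∑-distrib-+ (λ u → ⟦ R u ⟧ * degreeIn N[v] u) (λ u → ⟦ R u ⟧ * dR u) ⟩
        sum (λ u → ⟦ R u ⟧ * degreeIn N[v] u) + degreeSum R
          ≡⟨ cong (_+ degreeSum R) (degree-double-count R N[v]) ⟩
        sum (λ u → ⟦ N[v] u ⟧ * dR u) + degreeSum R ∎

    closed-neighbourhood-sum : sum (λ u → ⟦ N[v] u ⟧ * (degreeIn W u + degreeIn R u)) ≤ Δ + (Δ + suc s) * Δ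
    closed-neighbourhood-sum = begin
      sum (λ u → ⟦ N[v] u ⟧ * f u)
        ≡⟨ sum-cong-≗ (λ u → trans (cong (_* f u) (⟦N[v]⟧-split u)) (*-distribʳ-+ (f u) ⟦ δ v u ⟧ ⟦ N⟨v⟩ u ⟧)) ⟩
      sum (λ u → ⟦ δ v u ⟧ * f u + ⟦ N⟨v⟩ u ⟧ * f u)
        ≡⟨ ∑-distrib-+ (λ u → ⟦ δ v u ⟧ * f u) (λ u → ⟦ N⟨v⟩ u ⟧ * f u) ⟩
      sum (λ u → ⟦ δ v u ⟧ * f u) + sum (λ u → ⟦ N⟨v⟩ u ⟧ * f u)
        ≡⟨ cong (_+ sum (λ u → ⟦ N⟨v⟩ u ⟧ * f u)) (trans (sum-δ v f) (cong (Δ +_) degreeIn-R-v)) ⟩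
      Δ + 0 + sum (λ u → ⟦ N⟨v⟩ u ⟧ * f u)
        ≤⟨ +-mono-≤ (≤-reflexive (+-identityʳ Δ))
                    (sum-mono-≤ (λ u → ⟦⟧*-mono (N⟨v⟩ u) (λ vu → +-mono-≤ (v-max u (T-∧ˡ (W u) vu)) (degreeIn-R u)))) ⟩
      Δ + sum (λ u → ⟦ N⟨v⟩ u ⟧ * (Δ + suc s))
        ≡⟨ cong (Δ +_) (trans (sum-cong-≗ (λ u → *-comm ⟦ N⟨v⟩ u ⟧ (Δ + suc s)))
                              (sym (*-distribˡ-sum (Δ + suc s) (λ u → ⟦ N⟨v⟩ u ⟧)))) ⟩
      Δ + (Δ + suc s) * Δ ∎
      where
      open ≤-Reasoning
      f : Fin n → ℕ
      f u = degreeIn W u + degreeIn R u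

    count-W∸ : count W ∸ suc g ≡ Δ + s
    count-W∸ = begin
      count W ∸ suc g    ≡⟨ cong (_∸ suc g) count-W ⟩
      (Δ + r) ∸ g        ≡⟨ +-∸-assoc Δ g≤r ⟩
      Δ + s              ∎
      where open ≡-Reasoning

    step : degreeSum R ≤ s * (s + 2) → degreeSum W ≤ (count W ∸ suc g) * (count W ∸ suc g + 2)
    step IH rewrite count-W∸ = begin
      degreeSum W
        ≡⟨ degreeSum-split ⟩
      sum (λ u → ⟦ N[v] u ⟧ * (degreeIn W u + degreeIn R u)) + degreeSum R
        ≤⟨ +-mono-≤ closed-neighbourhood-sum IH ⟩
      Δ + (Δ + suc s) * Δ + s * (s + 2)
        ≤⟨ m≤m+n _ (s * Δ) ⟩
      Δ + (Δ + suc s) * Δ + s * (s + 2) + s * Δ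
        ≡⟨ expand Δ s ⟨
      (Δ + s) * (Δ + s + 2) ∎
      where
      open ≤-Reasoning
      expand : ∀ d s → (d + s) * (d + s + 2) ≡ d + (d + suc s) * d + s * (s + 2) + s * d
      expand = solve-∀

  vizing : ∀ g W → DominationAtLeast g W → degreeSum W ≤ (count W ∸ g) * (count W ∸ g + 2)
  vizing zero W _ = ≤-trans (degreeSum≤ W) (*-monoʳ-≤ (count W) (m≤m+n (count W) 2))
  vizing (suc g) W γW with count-nonempty W
  ... | inj₁ W-empty = ≤-trans (≤-trans (degreeSum≤ W) (≤-reflexive (cong (λ c → c * c) W-empty))) z≤n
  ... | inj₂ (u , Wu) with argmax-on W (degreeIn W) u Wu
  ...   | v , Wv , v-max = step (vizing g R γR)
    where open MaxDegreeStep g W γW v Wv v-max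

-- Dominating sets as Boolean vectors

∣∣≡count : ∀ {n} (S : Subset n) → ∣ S ∣ ≡ count (lookup S)
∣∣≡count [] = refl
∣∣≡count (true ∷ S) = cong suc (∣∣≡count S)
∣∣≡count (false ∷ S) = ∣∣≡count S

∣tabulate∣ : ∀ {n} (D : Fin n → Bool) → ∣ tabulate D ∣ ≡ count D
∣tabulate∣ D = trans (∣∣≡count (tabulate D)) (sum-cong-≗ (λ i → cong ⟦_⟧ (lookup∘tabulate D i)))

∈⇒T : ∀ {n} {S : Subset n} {i} → i ∈ₛ S → T (lookup S i)
∈⇒T i∈S = subst T (sym ([]=⇒lookup i∈S)) _

T⇒∈tabulate : ∀ {n} (D : Fin n → Bool) {i} → T (D i) → i ∈ₛ tabulate D
T⇒∈tabulate D {i} Di = lookup⇒[]= i (tabulate D) (trans (lookup∘tabulate D i) (T⇒≡true Di))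

everything : ∀ {n} → Fin n → Bool
everything _ = true

module _ {n} (G : Graph n) where
  open Vizing G

  dominating⇒dominates : ∀ S → Dominating G S → Dominates (lookup S) everything
  dominating⇒dominates S S-dom v _ with S-dom v
  ... | inj₁ v∈S = inj₁ (∈⇒T v∈S)
  ... | inj₂ (u , u∈S , u~v) = inj₂ (u , ∈⇒T u∈S , u~v)

  dominates⇒dominating : ∀ D → Dominates D everything → Dominating G (tabulate D)
  dominates⇒dominating D D-dom v with D-dom v _
  ... | inj₁ Dv = inj₁ (T⇒∈tabulate D Dv)
  ... | inj₂ (u , Du , u~v) = inj₂ (u , T⇒∈tabulate D Du , u~v)

  domNum-intro : ∀ D d → Dominates D everything → count D ≡ d →
                 (∀ D′ → Dominates D′ everything → d ≤ count D′) → DomNum G d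
  domNum-intro D d D-dom ∣D∣≡d minimal =
    (tabulate D , dominates⇒dominating D D-dom , trans (∣tabulate∣ D) ∣D∣≡d) ,
    λ S S-dom → subst (d ≤_) (sym (∣∣≡count S)) (minimal (lookup S) (dominating⇒dominates S S-dom))

  domNum-minimal : ∀ {d} → DomNum G d → DominationAtLeast d everything
  domNum-minimal (_ , minimal) D D-dom =
    subst (_ ≤_) (∣tabulate∣ D) (minimal (tabulate D) (dominates⇒dominating D D-dom))

  dominates⇒count≥1 : Fin n → ∀ D → Dominates D everything → 1 ≤ count D
  dominates⇒count≥1 v D D-dom with D-dom v _
  ... | inj₁ Dv = count≥1 D v Dv
  ... | inj₂ (u , Du , _) = count≥1 D u Du

  domNum-positive : ∀ {d} → Fin n → DomNum G d → 1 ≤ d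
  domNum-positive v ((S , S-dom , ∣S∣≡d) , _) =
    subst (1 ≤_) (trans (sym (∣∣≡count S)) ∣S∣≡d) (dominates⇒count≥1 v (lookup S) (dominating⇒dominates S S-dom))

domNum-K : ∀ n → Fin n → DomNum (K n) 1
domNum-K n v = domNum-intro (K n) (δ v) 1 v-dominates (count-δ v) (dominates⇒count≥1 (K n) v)
  where
  v-dominates : Vizing.Dominates (K n) (δ v) everything
  v-dominates w _ with δ v w in v≟w
  ... | true = inj₁ _
  ... | false = inj₂ (v , δ-refl v , T-not v≟w)

-- Counting edges

count₂ : ∀ {n} → (Fin n → Fin n → Bool) → ℕ
count₂ F = sum (λ i → count (F i))

count₂-cong : ∀ {n} {F F′ : Fin n → Fin n → Bool} → (∀ i j → F i j ≡ F′ i j) → count₂ F ≡ count₂ F′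
count₂-cong F≡F′ = sum-cong-≗ (λ i → sum-cong-≗ (λ j → cong ⟦_⟧ (F≡F′ i j)))

count₂-∨-disjoint : ∀ {n} (F F′ : Fin n → Fin n → Bool) → (∀ i j → T (F i j) → T (F′ i j) → ⊥) →
                    count₂ (λ i j → F i j ∨ F′ i j) ≡ count₂ F + count₂ F′
count₂-∨-disjoint F F′ disj =
  trans (sum-cong-≗ (λ i → count-∨-disjoint (F i) (F′ i) (disj i))) (∑-distrib-+ (λ i → count (F i)) (λ i → count (F′ i)))

count₂-+ : ∀ {n} (F F′ : Fin n → Fin n → Bool) →
           sum (λ i → sum (λ j → ⟦ F i j ⟧ + ⟦ F′ i j ⟧)) ≡ count₂ F + count₂ F′
count₂-+ F F′ = trans (sum-cong-≗ (λ i → ∑-distrib-+ (λ j → ⟦ F i j ⟧) (λ j → ⟦ F′ i j ⟧)))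
                      (∑-distrib-+ (λ i → count (F i)) (λ i → count (F′ i)))

count₂-∨≤ : ∀ {n} (F F′ : Fin n → Fin n → Bool) → count₂ (λ i j → F i j ∨ F′ i j) ≤ count₂ F + count₂ F′
count₂-∨≤ F F′ = ≤-trans (sum-mono-≤ (λ i → sum-mono-≤ (λ j → ⟦∨⟧≤ (F i j) (F′ i j)))) (≤-reflexive (count₂-+ F F′))

count₂-∧ : ∀ {n} (P Q : Fin n → Bool) → count₂ (λ i j → P i ∧ Q j) ≡ count P * count Q
count₂-∧ P Q = trans (sum-cong-≗ (λ i → sum-cong-≗ (λ j → ⟦∧⟧ (P i) (Q j)))) (sum-*-sum (λ i → ⟦ P i ⟧) (λ j → ⟦ Q j ⟧))

count₂-δ : ∀ {n} (a b : Fin n) → count₂ (λ i j → δ a i ∧ δ b j) ≡ 1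
count₂-δ a b = trans (count₂-∧ (δ a) (δ b)) (cong₂ _*_ (count-δ a) (count-δ b))

matches-inv : ∀ {n} {i j a b : Fin n} → T (matches i j (a , b)) → (a ≡ i × b ≡ j) ⊎ (a ≡ j × b ≡ i)
matches-inv {i = i} {j} {a} {b} m with T-∨-elim (δ a i ∧ δ b j) m
... | inj₁ ab≡ij = inj₁ (δ⇒≡ (T-∧ˡ (δ a i) ab≡ij) , δ⇒≡ (T-∧ʳ (δ a i) ab≡ij))
... | inj₂ ab≡ji = inj₂ (δ⇒≡ (T-∧ˡ (δ a j) ab≡ji) , δ⇒≡ (T-∧ʳ (δ a j) ab≡ji))

count₂-matches : ∀ {n} (a b : Fin n) → a Fin.< b → count₂ (λ i j → matches i j (a , b)) ≡ 2
count₂-matches a b a<b = trans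
  (count₂-∨-disjoint (λ i j → δ a i ∧ δ b j) (λ i j → δ a j ∧ δ b i) (λ i j ab≡ij ab≡ji →
     <-irrefl (cong toℕ (trans (δ⇒≡ (T-∧ˡ (δ a j) ab≡ji)) (sym (δ⇒≡ (T-∧ʳ (δ a i) ab≡ij))))) a<b))
  (cong₂ _+_ (count₂-δ a b) (trans (count₂-cong (λ i j → ∧-comm (δ a j) (δ b i))) (count₂-δ b a)))

inEdges⇒∈ : ∀ {n} (E : List (Fin n × Fin n)) {i j} → T (inEdges E i j) →
            Σ (Fin n × Fin n) λ p → p ∈ₗ E × T (matches i j p)
inEdges⇒∈ (p ∷ E) {i} {j} m with T-∨-elim (matches i j p) m
... | inj₁ here-m = p , here refl , here-m
... | inj₂ there-m with inEdges⇒∈ E there-m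
...   | q , q∈E , q-m = q , there q∈E , q-m

∈⇒inEdges : ∀ {n} (E : List (Fin n × Fin n)) {i j p} → p ∈ₗ E → T (matches i j p) → T (inEdges E i j)
∈⇒inEdges (q ∷ E) {i} {j} (here refl) m = T-∨ˡ (inEdges E i j) m
∈⇒inEdges (q ∷ E) {i} {j} (there p∈E) m = T-∨ʳ (matches i j q) (∈⇒inEdges E p∈E m)

Increasing : ∀ {n} → Fin n × Fin n → Set
Increasing (a , b) = a Fin.< b

matches-unique : ∀ {n} {i j : Fin n} p q → Increasing p → Increasing q →
                 T (matches i j p) → T (matches i j q) → p ≡ q
matches-unique (a , b) (c , d) a<b c<d m m′ with matches-inv {a = a} {b} m | matches-inv {a = c} {d} m′
... | inj₁ (refl , refl) | inj₁ (refl , refl) = refl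
... | inj₂ (refl , refl) | inj₂ (refl , refl) = refl
... | inj₁ (refl , refl) | inj₂ (refl , refl) = ⊥-elim (<-asym a<b c<d)
... | inj₂ (refl , refl) | inj₁ (refl , refl) = ⊥-elim (<-asym a<b c<d)

count₂-inEdges : ∀ {n} (E : List (Fin n × Fin n)) → All Increasing E → Unique E →
                 count₂ (inEdges E) ≡ 2 * length E
count₂-inEdges {n} [] [] [] = sum-zero {n} (λ i → sum-zero {n} (λ j → refl))
count₂-inEdges ((a , b) ∷ E) (a<b ∷ E-inc) (ab∉E ∷ E-unique) = begin
  count₂ (inEdges ((a , b) ∷ E))
    ≡⟨ count₂-∨-disjoint (λ i j → matches i j (a , b)) (inEdges E) disjoint ⟩
  count₂ (λ i j → matches i j (a , b)) + count₂ (inEdges E)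
    ≡⟨ cong₂ _+_ (count₂-matches a b a<b) (count₂-inEdges E E-inc E-unique) ⟩
  2 + 2 * length E
    ≡⟨ *-distribˡ-+ 2 1 (length E) ⟨
  2 * length ((a , b) ∷ E) ∎
  where
  open ≡-Reasoning
  disjoint : ∀ i j → T (matches i j (a , b)) → T (inEdges E i j) → ⊥
  disjoint i j m m∈E with inEdges⇒∈ E m∈E
  ... | q , q∈E , q-m = All.lookup ab∉E q∈E (matches-unique (a , b) q a<b (All.lookup E-inc q∈E) m q-m)

-- Ordered pairs of adjacent vertices, that is, twice the number of edges.
edgeCount : ∀ {n} → Graph n → ℕ
edgeCount G = count₂ (Adj G)

edgeCount-delete : ∀ {n} (G : Graph n) E → IsEdgeSet G E → edgeCount G ≡ edgeCount (delete G E) + 2 * length E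
edgeCount-delete G E (E-edges , E-unique) = begin
  edgeCount G
    ≡⟨ count₂-cong (λ i j → split (Adj G i j) (inEdges E i j)) ⟩
  count₂ (λ i j → Adj (delete G E) i j ∨ (Adj G i j ∧ inEdges E i j))
    ≡⟨ count₂-∨-disjoint (Adj (delete G E)) (λ i j → Adj G i j ∧ inEdges E i j) (λ i j → disjoint (Adj G i j) (inEdges E i j)) ⟩
  edgeCount (delete G E) + count₂ (λ i j → Adj G i j ∧ inEdges E i j)
    ≡⟨ cong (edgeCount (delete G E) +_) (count₂-cong (λ i j → on-edges i j)) ⟩
  edgeCount (delete G E) + count₂ (inEdges E)
    ≡⟨ cong (edgeCount (delete G E) +_) (count₂-inEdges E (All.map proj₁ E-edges) E-unique) ⟩
  edgeCount (delete G E) + 2 * length E ∎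
  where
  open ≡-Reasoning
  split : ∀ x y → x ≡ (x ∧ not y) ∨ (x ∧ y)
  split true true = refl
  split true false = refl
  split false y = refl
  disjoint : ∀ x y → T (x ∧ not y) → T (x ∧ y) → ⊥
  disjoint true true () _
  disjoint true false _ ()
  E-adjacent : ∀ i j → T (inEdges E i j) → T (Adj G i j)
  E-adjacent i j m with inEdges⇒∈ E m
  ... | (a , b) , ab∈E , ab-m with matches-inv {a = a} {b} ab-m | proj₂ (All.lookup E-edges ab∈E)
  ...   | inj₁ (refl , refl) | a~b = a~b
  ...   | inj₂ (refl , refl) | a~b = subst T (Adj-sym G a b) a~b
  on-edges : ∀ i j → (Adj G i j ∧ inEdges E i j) ≡ inEdges E i j
  on-edges i j with inEdges E i j in e
  ... | true = trans (∧-identityʳ (Adj G i j)) (T⇒≡true (E-adjacent i j (subst T (sym e) _)))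
  ... | false = ∧-zeroʳ (Adj G i j)

module EdgesOf {n} (Q : Fin n → Fin n → Bool) (Q-sym : ∀ i j → Q i j ≡ Q j i) where

  IncreasingQ : Fin n × Fin n → Set
  IncreasingQ (i , j) = i Fin.< j × T (Q i j)

  increasingQ? : ∀ p → Dec (IncreasingQ p)
  increasingQ? (i , j) = i Fin.<? j ×-dec T? (Q i j)

  pairs : List (Fin n × Fin n)
  pairs = cartesianProduct (allFin n) (allFin n)

  edges : List (Fin n × Fin n)
  edges = filter increasingQ? pairs

  edges-isEdgeSet : IsEdgeSet (K n) edges
  edges-isEdgeSet =
    All.map (λ { {i , j} (i<j , _) → i<j , T-not (≢⇒δ≡false (λ i≡j → <-irrefl (cong toℕ i≡j) i<j)) })
            (all-filter increasingQ? pairs) ,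
    filter⁺ increasingQ? (cartesianProduct⁺ (allFin⁺ n) (allFin⁺ n))

  inEdges-edges : ∀ i j → inEdges edges i j ≡ not (δ i j) ∧ Q i j
  inEdges-edges i j = T-ext to from
    where
    to : T (inEdges edges i j) → T (not (δ i j) ∧ Q i j)
    to m with inEdges⇒∈ edges m
    ... | (a , b) , ab∈ , ab-m with ∈-filter⁻ increasingQ? {xs = pairs} ab∈ | matches-inv {a = a} {b} ab-m
    ...   | _ , a<b , Qab | inj₁ (refl , refl) =
            T-∧-intro (T-not (≢⇒δ≡false (λ i≡j → <-irrefl (cong toℕ i≡j) a<b))) Qab
    ...   | _ , a<b , Qab | inj₂ (refl , refl) =
            T-∧-intro (T-not (≢⇒δ≡false (λ i≡j → <-irrefl (cong toℕ (sym i≡j)) a<b))) (subst T (Q-sym j i) Qab)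
    member : ∀ {a b} → a Fin.< b → T (Q a b) → (a , b) ∈ₗ edges
    member {a} {b} a<b Qab = ∈-filter⁺ increasingQ? (∈-cartesianProduct⁺ (∈-allFin a) (∈-allFin b)) (a<b , Qab)
    from : T (not (δ i j) ∧ Q i j) → T (inEdges edges i j)
    from p with Fin.<-cmp i j | T-∧ʳ (not (δ i j)) p
    ... | tri< i<j _ _ | Qij = ∈⇒inEdges edges (member i<j Qij) (T-∨ˡ _ (T-∧-intro (δ-refl i) (δ-refl j)))
    ... | tri≈ _ refl _ | _ = ⊥-elim (subst (λ x → T (not x)) (T⇒≡true (δ-refl i)) (T-∧ˡ (not (δ i i)) p))
    ... | tri> _ _ j<i | Qij = ∈⇒inEdges edges (member j<i (subst T (Q-sym i j) Qij)) (T-∨ʳ _ (T-∧-intro (δ-refl j) (δ-refl i)))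

  Adj-delete-edges : ∀ i j → Adj (delete (K n) edges) i j ≡ not (δ i j) ∧ not (Q i j)
  Adj-delete-edges i j = trans (cong (λ x → not (δ i j) ∧ not x) (inEdges-edges i j)) (simplify (δ i j) (Q i j))
    where
    simplify : ∀ x q → not x ∧ not (not x ∧ q) ≡ not x ∧ not q
    simplify true q = refl
    simplify false q = refl

-- The lower bound

vizing-bound : ∀ {n} (G : Graph n) {g} → DomNum G g → edgeCount G ≤ (n ∸ g) * (n ∸ g + 2)
vizing-bound {n} G {g} γ≡g = begin
  edgeCount G
    ≡⟨ sum-cong-≗ (λ u → +-identityʳ (count (Adj G u))) ⟨
  degreeSum everything
    ≤⟨ vizing g everything (domNum-minimal G γ≡g) ⟩
  (count {n} everything ∸ g) * (count {n} everything ∸ g + 2)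
    ≡⟨ cong (λ c → (c ∸ g) * (c ∸ g + 2)) (count-true n) ⟩
  (n ∸ g) * (n ∸ g + 2) ∎
  where
  open ≤-Reasoning
  open Vizing G

edgeCount-K : ∀ n → edgeCount (K n) ≡ n * (n ∸ 1)
edgeCount-K n = trans (sum-cong-≗ row) (sum-const n (n ∸ 1))
  where
  row : ∀ (i : Fin n) → count (λ j → not (δ i j)) ≡ n ∸ 1
  row i = trans (sym (m+n∸m≡n 1 (count (λ j → not (δ i j)))))
                (cong (_∸ 1) (trans (cong (_+ count (λ j → not (δ i j))) (sym (count-δ i))) (count-not (δ i))))

2*nC2 : ∀ n → 2 * (n C 2) ≡ n * (n ∸ 1)
2*nC2 zero = refl
2*nC2 (suc n) = begin
  2 * (suc n C 2)          ≡⟨ cong (2 *_) (nCk+nC[k+1]≡[n+1]C[k+1] n 1) ⟨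
  2 * (n C 1 + n C 2)      ≡⟨ cong (λ c → 2 * (c + n C 2)) (nC1≡n n) ⟩
  2 * (n + n C 2)          ≡⟨ *-distribˡ-+ 2 n (n C 2) ⟩
  2 * n + 2 * (n C 2)      ≡⟨ cong (2 * n +_) (2*nC2 n) ⟩
  2 * n + n * (n ∸ 1)      ≡⟨ shift n ⟩
  suc n * n                ∎
  where
  open ≡-Reasoning
  shift : ∀ n → 2 * n + n * (n ∸ 1) ≡ suc n * n
  shift zero = refl
  shift (suc n) = expand n
    where
    expand : ∀ n → 2 * suc n + suc n * n ≡ suc (suc n) * suc n
    expand = solve-∀

m∸n/2≤o : ∀ m n o → 2 * m ≤ n + 2 * o → m ∸ n / 2 ≤ o
m∸n/2≤o m n o 2m≤n+2o = m≤n+o⇒m∸n≤o m (n / 2) (≤-pred (*-cancelˡ-< 2 m (suc (n / 2 + o)) 2m<))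
  where
  2m< : 2 * m < 2 * suc (n / 2 + o)
  2m< = begin-strict
    2 * m                          ≤⟨ 2m≤n+2o ⟩
    n + 2 * o                      ≡⟨ cong (_+ 2 * o) (m≡m%n+[m/n]*n n 2) ⟩
    n % 2 + n / 2 * 2 + 2 * o      <⟨ +-monoˡ-< (2 * o) (+-monoˡ-< (n / 2 * 2) (m%n<n n 2)) ⟩
    2 + n / 2 * 2 + 2 * o          ≡⟨ regroup (n / 2) o ⟩
    2 * suc (n / 2 + o)            ∎
    where
    open ≤-Reasoning
    regroup : ∀ q o → 2 + q * 2 + 2 * o ≡ 2 * suc (q + o)
    regroup = solve-∀

o≤m∸n/2 : ∀ m n o → 2 * o + n ≤ 2 * m + n % 2 → o ≤ m ∸ n / 2
o≤m∸n/2 m n o 2o+n≤2m+r = m+n≤o⇒m≤o∸n o (*-cancelˡ-≤ 2 (+-cancelʳ-≤ (n % 2) _ _ (begin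
  2 * (o + n / 2) + n % 2        ≡⟨ regroup o (n / 2) (n % 2) ⟩
  2 * o + (n % 2 + n / 2 * 2)    ≡⟨ cong (2 * o +_) (m≡m%n+[m/n]*n n 2) ⟨
  2 * o + n                      ≤⟨ 2o+n≤2m+r ⟩
  2 * m + n % 2                  ∎)))
  where
  open ≤-Reasoning
  regroup : ∀ o q r → 2 * (o + q) + r ≡ 2 * o + (r + q * 2)
  regroup = solve-∀

sb-lower : ∀ n k → k + 1 ≤ n → ∀ E → Bondage (K n) k E →
           n C 2 ∸ ((n ∸ k ∸ 1) * (n ∸ k + 1)) / 2 ≤ length E
sb-lower n k k+1≤n E (E-edges , d , γK≡d , γH≡d+k) = m∸n/2≤o (n C 2) ((n ∸ k ∸ 1) * (n ∸ k + 1)) (length E) (begin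
  2 * (n C 2)                                          ≡⟨ 2*nC2 n ⟩
  n * (n ∸ 1)                                          ≡⟨ edgeCount-K n ⟨
  edgeCount (K n)                                      ≡⟨ edgeCount-delete (K n) E E-edges ⟩
  edgeCount H + 2 * length E                           ≤⟨ +-monoˡ-≤ (2 * length E) (vizing-bound H γH≡d+k) ⟩
  (n ∸ (d + k)) * (n ∸ (d + k) + 2) + 2 * length E     ≤⟨ +-monoˡ-≤ (2 * length E) (*-mono-≤ t≤ (+-monoˡ-≤ 2 t≤)) ⟩
  (n ∸ k ∸ 1) * (n ∸ k ∸ 1 + 2) + 2 * length E         ≡⟨ cong (λ x → (n ∸ k ∸ 1) * x + 2 * length E) +2≡+1 ⟩
  (n ∸ k ∸ 1) * (n ∸ k + 1) + 2 * length E             ∎)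
  where
  open ≤-Reasoning
  H : Graph n
  H = delete (K n) E
  1≤n∸k : 1 ≤ n ∸ k
  1≤n∸k = m+n≤o⇒m≤o∸n 1 (subst (_≤ n) (+-comm k 1) k+1≤n)
  1≤d : 1 ≤ d
  1≤d = domNum-positive (K n) (Fin.fromℕ< (≤-trans 1≤n∸k (m∸n≤m n k))) γK≡d
  t≤ : n ∸ (d + k) ≤ n ∸ k ∸ 1
  t≤ = subst (n ∸ (d + k) ≤_) (sym (∸-+-assoc n k 1)) (∸-monoʳ-≤ n (subst (_≤ d + k) (+-comm 1 k) (+-monoˡ-≤ k 1≤d)))
  +2≡+1 : n ∸ k ∸ 1 + 2 ≡ n ∸ k + 1
  +2≡+1 = trans (sym (+-assoc (n ∸ k ∸ 1) 1 1)) (cong (_+ 1) (m∸n+n≡m 1≤n∸k))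

-- The extremal graph

partner : ℕ → ℕ
partner zero = 1
partner (suc zero) = 0
partner (suc (suc x)) = suc (suc (partner x))

odd : ℕ → Bool
odd zero = false
odd (suc zero) = true
odd (suc (suc x)) = odd x

partner-sym : ∀ x y → (y ≡ᵇ partner x) ≡ (x ≡ᵇ partner y)
partner-sym zero zero = refl
partner-sym zero (suc zero) = refl
partner-sym zero (suc (suc y)) = refl
partner-sym (suc zero) zero = refl
partner-sym (suc zero) (suc zero) = refl
partner-sym (suc zero) (suc (suc y)) = refl
partner-sym (suc (suc x)) zero = refl
partner-sym (suc (suc x)) (suc zero) = refl
partner-sym (suc (suc x)) (suc (suc y)) = partner-sym x y

partner≢ : ∀ x → ¬ partner x ≡ x
partner≢ zero ()
partner≢ (suc zero) ()
partner≢ (suc (suc x)) eq = partner≢ x (suc-injective (suc-injective eq))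

partner≤ : ∀ x → partner x ≤ suc x
partner≤ zero = ≤-refl
partner≤ (suc zero) = z≤n
partner≤ (suc (suc x)) = s≤s (s≤s (partner≤ x))

partner≡suc⇒odd : ∀ x → partner x ≡ suc x → odd (suc x) ≡ true
partner≡suc⇒odd zero _ = refl
partner≡suc⇒odd (suc zero) ()
partner≡suc⇒odd (suc (suc x)) eq = partner≡suc⇒odd x (suc-injective (suc-injective eq))

odd⇒partner≡suc : ∀ m → odd (suc m) ≡ true → partner m ≡ suc m
odd⇒partner≡suc zero _ = refl
odd⇒partner≡suc (suc zero) ()
odd⇒partner≡suc (suc (suc m)) odd-m = cong (λ x → suc (suc x)) (odd⇒partner≡suc m odd-m)

odd⇒∃[h]n≡1+h*2 : ∀ m → odd m ≡ true → Σ ℕ λ h → m ≡ suc (h * 2)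
odd⇒∃[h]n≡1+h*2 (suc zero) _ = 0 , refl
odd⇒∃[h]n≡1+h*2 (suc (suc zero)) ()
odd⇒∃[h]n≡1+h*2 (suc (suc (suc m))) odd-m with odd⇒∃[h]n≡1+h*2 (suc m) odd-m
... | h , refl = suc h , refl

⟦odd⟧≤[n*[2+n]]%2 : ∀ m₀ → ⟦ odd m₀ ⟧ ≤ (m₀ * (2 + m₀)) % 2
⟦odd⟧≤[n*[2+n]]%2 m₀ with odd m₀ in odd-m₀
... | false = z≤n
... | true with odd⇒∃[h]n≡1+h*2 m₀ odd-m₀
...   | h , refl = ≤-reflexive (sym (trans (cong (_% 2) (expand h)) ([m+kn]%n≡m%n 1 (h * h * 2 + h * 4 + 1) 2)))
  where
  expand : ∀ h → suc (h * 2) * (2 + suc (h * 2)) ≡ 1 + (h * h * 2 + h * 4 + 1) * 2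
  expand = solve-∀

count-<ᵇ : ∀ {n} m → m ≤ n → count {n} (λ j → toℕ j <ᵇ m) ≡ m
count-<ᵇ {n} zero _ = sum-zero {n} (λ _ → refl)
count-<ᵇ {suc n} (suc m) (s≤s m≤n) = cong suc (count-<ᵇ {n} m m≤n)

count-≡ᵇ≤1 : ∀ {n} c → count {n} (λ i → toℕ i ≡ᵇ c) ≤ 1
count-≡ᵇ≤1 {zero} c = z≤n
count-≡ᵇ≤1 {suc n} zero = ≤-reflexive (cong suc (sum-zero {n} (λ _ → refl)))
count-≡ᵇ≤1 {suc n} (suc c) = count-≡ᵇ≤1 {n} c

count-≡ᵇ : ∀ {n} c → c < n → count {n} (λ i → toℕ i ≡ᵇ c) ≡ 1
count-≡ᵇ {suc n} zero _ = cong suc (sum-zero {n} (λ _ → refl))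
count-≡ᵇ {suc n} (suc c) (s≤s c<n) = count-≡ᵇ {n} c c<n

count-<ᵇ∧≡ᵇ : ∀ {n} m c → count {n} (λ j → (toℕ j <ᵇ m) ∧ (toℕ j ≡ᵇ c)) ≤ ⟦ c <ᵇ m ⟧
count-<ᵇ∧≡ᵇ {zero} m c = z≤n
count-<ᵇ∧≡ᵇ {suc n} zero c = ≤-reflexive (sum-zero {suc n} (λ _ → refl))
count-<ᵇ∧≡ᵇ {suc n} (suc m) zero =
  ≤-reflexive (cong suc (sum-zero {n} (λ j → cong ⟦_⟧ (∧-zeroʳ (toℕ j <ᵇ m)))))
count-<ᵇ∧≡ᵇ {suc n} (suc m) (suc c) = count-<ᵇ∧≡ᵇ {n} m c

<ᵇ-irrefl : ∀ x → (x <ᵇ x) ≡ false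
<ᵇ-irrefl zero = refl
<ᵇ-irrefl (suc x) = <ᵇ-irrefl x

<⇒<ᵇ≡true : ∀ {x y} → x < y → (x <ᵇ y) ≡ true
<⇒<ᵇ≡true x<y = T⇒≡true (<⇒<ᵇ x<y)

-- The vertices 0 , … , m − 1 form the core; every edge leaving the core is deleted.
module Construction (n m₀ : ℕ) (m≤n : 2 + m₀ ≤ n) where

  m last : ℕ
  m = 2 + m₀
  last = suc m₀

  core : ℕ → Bool
  core x = x <ᵇ m

  inCore : Fin n → Bool
  inCore i = core (toℕ i)

  special : ℕ → ℕ → Bool
  special x y = odd m ∧ (((x ≡ᵇ 0) ∧ (y ≡ᵇ last)) ∨ ((x ≡ᵇ last) ∧ (y ≡ᵇ 0)))

  -- For even m the pairs {x , partner x} form a perfect matching of the core; for odd m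
  -- the vertex last has its partner outside, and is matched to 0 instead.
  paired : ℕ → ℕ → Bool
  paired x y = (y ≡ᵇ partner x) ∨ special x y

  removedℕ : ℕ → ℕ → Bool
  removedℕ x y = not (core x) ∨ (not (core y) ∨ paired x y)

  removed : Fin n → Fin n → Bool
  removed i j = removedℕ (toℕ i) (toℕ j)

  removed-sym : ∀ i j → removed i j ≡ removed j i
  removed-sym i j = swap (not (core x)) (not (core y)) (cong₂ _∨_ (partner-sym x y) special-sym)
    where
    x y : ℕ
    x = toℕ i
    y = toℕ j
    special-sym : special x y ≡ special y x
    special-sym = cong (odd m ∧_) (trans (∨-comm ((x ≡ᵇ 0) ∧ (y ≡ᵇ last)) ((x ≡ᵇ last) ∧ (y ≡ᵇ 0)))
                                         (cong₂ _∨_ (∧-comm (x ≡ᵇ last) (y ≡ᵇ 0)) (∧-comm (x ≡ᵇ 0) (y ≡ᵇ last))))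
    swap : ∀ a b {c c′} → c ≡ c′ → a ∨ (b ∨ c) ≡ b ∨ (a ∨ c′)
    swap true true refl = refl
    swap true false refl = refl
    swap false true refl = refl
    swap false false refl = refl

  open EdgesOf removed removed-sym public using (edges-isEdgeSet) renaming (edges to E)
  open EdgesOf removed removed-sym using (Adj-delete-edges)

  H : Graph n
  H = delete (K n) E

  core-count : count inCore ≡ m
  core-count = count-<ᵇ m m≤n

  count₂-core² : count₂ {n} (λ i j → inCore i ∧ inCore j) ≡ m * m
  count₂-core² = trans (count₂-∧ inCore inCore) (cong₂ _*_ core-count core-count)

  count₂-diagonal : count₂ {n} (λ i j → δ i j ∧ inCore j) ≡ m
  count₂-diagonal = trans (sum-cong-≗ (λ i → trans (sum-cong-≗ (λ j → ⟦∧⟧ (δ i j) (inCore j)))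
                                                   (sum-δ i (λ j → ⟦ inCore j ⟧))))
                          core-count

  count₂-special : ∀ o → count₂ {n} (λ i j → o ∧ (((toℕ i ≡ᵇ 0) ∧ (toℕ j ≡ᵇ last)) ∨ ((toℕ i ≡ᵇ last) ∧ (toℕ j ≡ᵇ 0))))
                   ≤ 2 * ⟦ o ⟧
  count₂-special false = ≤-reflexive (sum-zero {n} (λ i → sum-zero {n} (λ j → refl)))
  count₂-special true = ≤-trans (count₂-∨≤ {n} (λ i j → (toℕ i ≡ᵇ 0) ∧ (toℕ j ≡ᵇ last)) (λ i j → (toℕ i ≡ᵇ last) ∧ (toℕ j ≡ᵇ 0)))
                                (+-mono-≤ (at-most-one 0 last) (at-most-one last 0))
    where
    at-most-one : ∀ a b → count₂ (λ (i j : Fin n) → (toℕ i ≡ᵇ a) ∧ (toℕ j ≡ᵇ b)) ≤ 1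
    at-most-one a b = ≤-trans (≤-reflexive (count₂-∧ {n} (λ i → toℕ i ≡ᵇ a) (λ j → toℕ j ≡ᵇ b)))
                              (*-mono-≤ (count-≡ᵇ≤1 {n} a) (count-≡ᵇ≤1 {n} b))

  -- Only last can have its partner outside the core, and only when m is odd.
  partner-row : ∀ x → ⟦ core x ⟧ * ⟦ core (partner x) ⟧ + ⟦ odd m ⟧ * ⟦ x ≡ᵇ last ⟧ ≤ ⟦ core x ⟧
  partner-row x with x ≡ᵇ last in x≟last
  ... | false = ≤-trans (≤-reflexive (trans (cong (⟦ core x ⟧ * ⟦ core (partner x) ⟧ +_) (*-zeroʳ ⟦ odd m ⟧))
                                            (+-identityʳ _)))
                        (≤-trans (*-monoʳ-≤ ⟦ core x ⟧ (⟦⟧≤1 (core (partner x)))) (≤-reflexive (*-identityʳ _)))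
  ... | true with ≡ᵇ⇒≡ x last (subst T (sym x≟last) _)
  ...   | refl rewrite <⇒<ᵇ≡true (n<1+n last) with odd m in odd-m
  ...     | true rewrite odd⇒partner≡suc last odd-m | <ᵇ-irrefl m = ≤-refl
  ...     | false = ≤-trans (≤-reflexive (+-identityʳ _)) (≤-trans (≤-reflexive (+-identityʳ _)) (⟦⟧≤1 _))

  count₂-partner : count₂ {n} (λ i j → (inCore i ∧ inCore j) ∧ (toℕ j ≡ᵇ partner (toℕ i))) + ⟦ odd m ⟧ ≤ m
  count₂-partner = begin
    sum {n} (λ i → count (λ j → (inCore i ∧ inCore j) ∧ (toℕ j ≡ᵇ partner (toℕ i)))) + ⟦ odd m ⟧
      ≤⟨ +-monoˡ-≤ ⟦ odd m ⟧ (sum-mono-≤ row) ⟩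
    sum {n} (λ i → ⟦ inCore i ⟧ * ⟦ core (partner (toℕ i)) ⟧) + ⟦ odd m ⟧
      ≡⟨ cong (sum {n} (λ i → ⟦ inCore i ⟧ * ⟦ core (partner (toℕ i)) ⟧) +_) last-once ⟨
    sum {n} (λ i → ⟦ inCore i ⟧ * ⟦ core (partner (toℕ i)) ⟧) + sum {n} (λ i → ⟦ odd m ⟧ * ⟦ toℕ i ≡ᵇ last ⟧)
      ≡⟨ ∑-distrib-+ (λ (i : Fin n) → ⟦ inCore i ⟧ * ⟦ core (partner (toℕ i)) ⟧) (λ i → ⟦ odd m ⟧ * ⟦ toℕ i ≡ᵇ last ⟧) ⟨
    sum {n} (λ i → ⟦ inCore i ⟧ * ⟦ core (partner (toℕ i)) ⟧ + ⟦ odd m ⟧ * ⟦ toℕ i ≡ᵇ last ⟧)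
      ≤⟨ sum-mono-≤ (λ (i : Fin n) → partner-row (toℕ i)) ⟩
    count inCore
      ≡⟨ core-count ⟩
    m ∎
    where
    open ≤-Reasoning
    factor : ∀ a b q → ⟦ (a ∧ b) ∧ q ⟧ ≡ ⟦ a ⟧ * ⟦ b ∧ q ⟧
    factor true b q = sym (+-identityʳ _)
    factor false b q = refl
    row : ∀ i → count (λ j → (inCore i ∧ inCore j) ∧ (toℕ j ≡ᵇ partner (toℕ i))) ≤ ⟦ inCore i ⟧ * ⟦ core (partner (toℕ i)) ⟧
    row i = begin
      sum (λ j → ⟦ (inCore i ∧ inCore j) ∧ (toℕ j ≡ᵇ partner (toℕ i)) ⟧)
        ≡⟨ sum-cong-≗ (λ j → factor (inCore i) (inCore j) (toℕ j ≡ᵇ partner (toℕ i))) ⟩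
      sum (λ j → ⟦ inCore i ⟧ * ⟦ inCore j ∧ (toℕ j ≡ᵇ partner (toℕ i)) ⟧)
        ≡⟨ *-distribˡ-sum ⟦ inCore i ⟧ (λ j → ⟦ inCore j ∧ (toℕ j ≡ᵇ partner (toℕ i)) ⟧) ⟨
      ⟦ inCore i ⟧ * count (λ j → inCore j ∧ (toℕ j ≡ᵇ partner (toℕ i)))
        ≤⟨ *-monoʳ-≤ ⟦ inCore i ⟧ (count-<ᵇ∧≡ᵇ {n} m (partner (toℕ i))) ⟩
      ⟦ inCore i ⟧ * ⟦ core (partner (toℕ i)) ⟧ ∎
    last-once : sum (λ (i : Fin n) → ⟦ odd m ⟧ * ⟦ toℕ i ≡ᵇ last ⟧) ≡ ⟦ odd m ⟧
    last-once = trans (sym (*-distribˡ-sum ⟦ odd m ⟧ (λ (i : Fin n) → ⟦ toℕ i ≡ᵇ last ⟧)))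
                      (trans (cong (⟦ odd m ⟧ *_) (count-≡ᵇ {n} last m≤n)) (*-identityʳ _))

  count₂-paired : count₂ {n} (λ i j → (inCore i ∧ inCore j) ∧ paired (toℕ i) (toℕ j)) ≤ m + ⟦ odd m ⟧
  count₂-paired = +-cancelʳ-≤ ⟦ odd m ⟧ _ _ (begin
    count₂ {n} (λ i j → (inCore i ∧ inCore j) ∧ paired (toℕ i) (toℕ j)) + ⟦ odd m ⟧
      ≤⟨ +-monoˡ-≤ ⟦ odd m ⟧ (≤-trans (sum-mono-≤ (λ i → sum-mono-≤ (λ j → split (inCore i ∧ inCore j) _ _)))
                                      (≤-reflexive (count₂-+ P S))) ⟩
    count₂ P + count₂ S + ⟦ odd m ⟧
      ≡⟨ +-assoc (count₂ P) (count₂ S) ⟦ odd m ⟧ ⟩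
    count₂ P + (count₂ S + ⟦ odd m ⟧)
      ≡⟨ cong (count₂ P +_) (+-comm (count₂ S) ⟦ odd m ⟧) ⟩
    count₂ P + (⟦ odd m ⟧ + count₂ S)
      ≡⟨ +-assoc (count₂ P) ⟦ odd m ⟧ (count₂ S) ⟨
    count₂ P + ⟦ odd m ⟧ + count₂ S
      ≤⟨ +-mono-≤ count₂-partner (count₂-special (odd m)) ⟩
    m + 2 * ⟦ odd m ⟧
      ≡⟨ regroup m ⟦ odd m ⟧ ⟩
    m + ⟦ odd m ⟧ + ⟦ odd m ⟧ ∎)
    where
    open ≤-Reasoning
    P S : Fin n → Fin n → Bool
    P i j = (inCore i ∧ inCore j) ∧ (toℕ j ≡ᵇ partner (toℕ i))
    S i j = special (toℕ i) (toℕ j)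
    split : ∀ a p s → ⟦ a ∧ (p ∨ s) ⟧ ≤ ⟦ a ∧ p ⟧ + ⟦ s ⟧
    split true true s = s≤s z≤n
    split true false s = ≤-refl
    split false p s = z≤n
    regroup : ∀ m o → m + 2 * o ≡ m + o + o
    regroup = solve-∀

  edgeCount-H : m₀ * m ≤ edgeCount H + ⟦ odd m ⟧
  edgeCount-H = +-cancelʳ-≤ (m + m) (m₀ * m) (edgeCount H + ⟦ odd m ⟧) (begin
    m₀ * m + (m + m)
      ≡⟨ square m₀ ⟩
    m * m
      ≡⟨ count₂-core² ⟨
    count₂ {n} (λ i j → inCore i ∧ inCore j)
      ≤⟨ sum-mono-≤ (λ i → sum-mono-≤ (pointwise i)) ⟩
    sum {n} (λ i → sum (λ j → ⟦ Adj H i j ⟧ + (⟦ δ i j ∧ inCore j ⟧ + ⟦ (inCore i ∧ inCore j) ∧ paired (toℕ i) (toℕ j) ⟧)))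
      ≡⟨ sum-cong-≗ (λ i → ∑-distrib-+ (λ j → ⟦ Adj H i j ⟧) _) ⟩
    sum {n} (λ i → count (Adj H i) + sum (λ j → ⟦ δ i j ∧ inCore j ⟧ + ⟦ (inCore i ∧ inCore j) ∧ paired (toℕ i) (toℕ j) ⟧))
      ≡⟨ ∑-distrib-+ (λ i → count (Adj H i)) _ ⟩
    edgeCount H + sum {n} (λ i → sum (λ j → ⟦ δ i j ∧ inCore j ⟧ + ⟦ (inCore i ∧ inCore j) ∧ paired (toℕ i) (toℕ j) ⟧))
      ≡⟨ cong (edgeCount H +_) (count₂-+ (λ i j → δ i j ∧ inCore j) (λ i j → (inCore i ∧ inCore j) ∧ paired (toℕ i) (toℕ j))) ⟩
    edgeCount H + (count₂ {n} (λ i j → δ i j ∧ inCore j) + count₂ {n} (λ i j → (inCore i ∧ inCore j) ∧ paired (toℕ i) (toℕ j)))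
      ≤⟨ +-monoʳ-≤ (edgeCount H) (+-mono-≤ (≤-reflexive count₂-diagonal) count₂-paired) ⟩
    edgeCount H + (m + (m + ⟦ odd m ⟧))
      ≡⟨ regroup (edgeCount H) m ⟦ odd m ⟧ ⟩
    edgeCount H + ⟦ odd m ⟧ + (m + m) ∎)
    where
    open ≤-Reasoning
    square : ∀ m₀ → m₀ * (2 + m₀) + ((2 + m₀) + (2 + m₀)) ≡ (2 + m₀) * (2 + m₀)
    square = solve-∀
    regroup : ∀ e m o → e + (m + (m + o)) ≡ e + o + (m + m)
    regroup = solve-∀
    cover : ∀ a b e p → ⟦ a ∧ b ⟧ ≤ ⟦ not e ∧ not (not a ∨ (not b ∨ p)) ⟧ + (⟦ e ∧ b ⟧ + ⟦ (a ∧ b) ∧ p ⟧)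
    cover false b e p = z≤n
    cover true false e p = z≤n
    cover true true true p = s≤s z≤n
    cover true true false true = s≤s z≤n
    cover true true false false = ≤-refl
    pointwise : ∀ i j → ⟦ inCore i ∧ inCore j ⟧ ≤
                ⟦ Adj H i j ⟧ + (⟦ δ i j ∧ inCore j ⟧ + ⟦ (inCore i ∧ inCore j) ∧ paired (toℕ i) (toℕ j) ⟧)
    pointwise i j rewrite Adj-delete-edges i j = cover (inCore i) (inCore j) (δ i j) (paired (toℕ i) (toℕ j))

  outside : Fin n → Bool
  outside i = not (inCore i)

  outside-count : count outside ≡ n ∸ m
  outside-count = trans (sym (m+n∸m≡n m (count outside)))
                        (cong (_∸ m) (trans (cong (_+ count outside) (sym core-count)) (count-not inCore)))

  adjacent⇒core-unpaired : ∀ {u v} → T (Adj H u v) → inCore u ≡ true × inCore v ≡ true × paired (toℕ u) (toℕ v) ≡ false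
  adjacent⇒core-unpaired {u} {v} u~v = not-removed (T-not⁻¹ (T-∧ʳ (not (δ u v)) u~v′))
    where
    u~v′ : T (not (δ u v) ∧ not (removed u v))
    u~v′ = subst T (Adj-delete-edges u v) u~v
    not-removed : removed u v ≡ false → inCore u ≡ true × inCore v ≡ true × paired (toℕ u) (toℕ v) ≡ false
    not-removed eq with inCore u | inCore v | paired (toℕ u) (toℕ v)
    ... | true | true | false = refl , refl , refl

  paired-1 : ∀ y → paired 1 (2 + y) ≡ false
  paired-1 y = trans (cong (odd m ∧_) (∧-zeroʳ (0 ≡ᵇ m₀))) (∧-zeroʳ (odd m))

  mate : ∀ x → T (core x) → Σ ℕ λ y → T (core y) × ¬ y ≡ x × T (paired x y)
  mate x x∈core with core (partner x) in partner∈core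
  ... | true = partner x , subst T (sym partner∈core) _ , partner≢ x ,
               T-∨ˡ (special x (partner x)) (≡⇒≡ᵇ (partner x) (partner x) refl)
  ... | false = 0 , _ , (λ 0≡x → 0≢last (trans 0≡x x≡last)) , T-∨ʳ (0 ≡ᵇ partner x) last-special
    where
    x<m : x < m
    x<m = <ᵇ⇒< x m x∈core
    m≤partner : m ≤ partner x
    m≤partner = ≮⇒≥ (λ p<m → subst T partner∈core (<⇒<ᵇ p<m))
    1+x≡m : suc x ≡ m
    1+x≡m = ≤-antisym x<m (≤-trans m≤partner (partner≤ x))
    x≡last : x ≡ last
    x≡last = suc-injective 1+x≡m
    0≢last : ¬ 0 ≡ last
    0≢last ()
    odd-m : odd m ≡ true
    odd-m = subst (λ y → odd y ≡ true) 1+x≡m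
                  (partner≡suc⇒odd x (≤-antisym (partner≤ x) (subst (_≤ partner x) (sym 1+x≡m) m≤partner)))
    last-special : T (special x 0)
    last-special = T-∧-intro (subst T (sym odd-m) _) (T-∨ʳ ((x ≡ᵇ 0) ∧ (0 ≡ᵇ last)) (T-∧-intro (≡⇒≡ᵇ x last x≡last) _))

  open Vizing H using (Dominates)

  vertex : ∀ x → x < m → Fin n
  vertex x x<m = fromℕ< (≤-trans x<m m≤n)

  toℕ-vertex : ∀ x x<m → toℕ (vertex x x<m) ≡ x
  toℕ-vertex x x<m = toℕ-fromℕ< (≤-trans x<m m≤n)

  0<m : 0 < m
  0<m = s≤s z≤n

  zero′ : Fin n
  zero′ = vertex 0 0<m

  small : Fin n → Bool
  small v = toℕ v <ᵇ 2

  small-or-outside : Fin n → Bool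
  small-or-outside v = small v ∨ outside v

  small-or-outside-count : count small-or-outside ≡ 2 + (n ∸ m)
  small-or-outside-count = begin
    count small-or-outside     ≡⟨ count-∨-disjoint small outside small⇒core ⟩
    count small + count outside ≡⟨ cong₂ _+_ (count-<ᵇ 2 (≤-trans (s≤s (s≤s z≤n)) m≤n)) outside-count ⟩
    2 + (n ∸ m)                 ∎
    where
    open ≡-Reasoning
    small⇒core : ∀ v → T (small v) → T (outside v) → ⊥
    small⇒core v v<2 v∉core = subst (λ b → T (not b)) (<⇒<ᵇ≡true (≤-trans (<ᵇ⇒< (toℕ v) 2 v<2) (s≤s (s≤s z≤n)))) v∉core

  not-removed⇒adjacent : ∀ u v → ¬ toℕ u ≡ toℕ v → removed u v ≡ false → T (Adj H u v)
  not-removed⇒adjacent u v u≢v not-removed rewrite Adj-delete-edges u v =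
    T-∧-intro (T-not (≢⇒δ≡false (λ u≡v → u≢v (cong toℕ u≡v)))) (T-not not-removed)

  -- Vertex 1 is adjacent to every core vertex other than 0 and 1.
  small-or-outside-dominates : Dominates small-or-outside everything
  small-or-outside-dominates v _ with small v in v≟small | inCore v in v∈core
  ... | true | _ = inj₁ _
  ... | false | false = inj₁ _
  ... | false | true = inj₂ (one , T-∨ˡ (outside one) (subst (λ x → T (x <ᵇ 2)) (sym toℕ-one) _) , one~v)
    where
    1<m : 1 < m
    1<m = s≤s (s≤s z≤n)
    one : Fin n
    one = vertex 1 1<m
    toℕ-one : toℕ one ≡ 1
    toℕ-one = toℕ-vertex 1 1<m
    removed-1 : ∀ y → core y ≡ true → (y <ᵇ 2) ≡ false → removedℕ 1 y ≡ false
    removed-1 (suc (suc y)) y∈core _ rewrite y∈core = paired-1 y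
    one~v : T (Adj H one v)
    one~v = not-removed⇒adjacent one v (λ 1≡v → subst (λ x → T (not (x <ᵇ 2))) (trans (sym 1≡v) toℕ-one) (T-not v≟small))
              (trans (cong (λ x → removedℕ x (toℕ v)) toℕ-one) (removed-1 (toℕ v) v∈core v≟small))

  module _ (D : Fin n → Bool) (D-dom : Dominates D everything) where

    outside⊆D : ∀ v → T (outside v) → T (D v)
    outside⊆D v v∉core with D-dom v _
    ... | inj₁ Dv = Dv
    ... | inj₂ (u , _ , u~v) =
      ⊥-elim (subst (λ b → T (not b)) (proj₁ (proj₂ (adjacent⇒core-unpaired u~v))) v∉core)

    core-member : Σ (Fin n) λ a → T (D a) × T (inCore a)
    core-member with D-dom zero′ _
    ... | inj₁ D0 = zero′ , D0 , subst (λ x → T (core x)) (sym (toℕ-vertex 0 0<m)) _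
    ... | inj₂ (u , Du , u~0) = u , Du , subst T (sym (proj₁ (adjacent⇒core-unpaired u~0))) _

    second-core-member : ∀ a → T (D a) → T (inCore a) → Σ (Fin n) λ c → T (D c) × T (inCore c) × ¬ c ≡ a
    second-core-member a Da a∈core with mate (toℕ a) a∈core
    ... | y , y∈core , y≢a , a-y = from-b (D-dom b _)
      where
      y<m : y < m
      y<m = <ᵇ⇒< y m y∈core
      b : Fin n
      b = vertex y y<m
      from-b : T (D b) ⊎ Σ (Fin n) (λ u → T (D u) × T (Adj H u b)) → Σ (Fin n) λ c → T (D c) × T (inCore c) × ¬ c ≡ a
      from-b (inj₁ Db) = b , Db , subst (λ x → T (core x)) (sym (toℕ-vertex y y<m)) y∈core ,
                         λ b≡a → y≢a (trans (sym (toℕ-vertex y y<m)) (cong toℕ b≡a))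
      from-b (inj₂ (c , Dc , c~b)) = c , Dc , subst T (sym c∈core) _ , c≢a
        where
        c∈core : inCore c ≡ true
        c∈core = proj₁ (adjacent⇒core-unpaired c~b)
        c≢a : ¬ c ≡ a
        c≢a refl = subst T (trans (cong (paired (toℕ a)) (sym (toℕ-vertex y y<m)))
                                  (proj₂ (proj₂ (adjacent⇒core-unpaired c~b)))) a-y

    lower-bound : 2 + (n ∸ m) ≤ count D
    lower-bound with core-member
    ... | a , Da , a∈core with second-core-member a Da a∈core
    ...   | c , Dc , c∈core , c≢a = begin
      2 + (n ∸ m)                               ≡⟨ cong (2 +_) outside-count ⟨
      2 + count outside                         ≡⟨ cong suc (count-insert-disjoint c outside (core∉outside c c∈core)) ⟨
      suc (count (λ v → δ c v ∨ outside v))     ≡⟨ count-insert-disjoint a (λ v → δ c v ∨ outside v) a-fresh ⟨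
      count (λ v → δ a v ∨ (δ c v ∨ outside v)) ≤⟨ count-mono included ⟩
      count D                                   ∎
      where
      open ≤-Reasoning
      core∉outside : ∀ v → T (inCore v) → ¬ T (outside v)
      core∉outside v v∈core = subst (λ x → T (not x)) (T⇒≡true v∈core)
      a-fresh : ¬ T (δ c a ∨ outside a)
      a-fresh c≡a∨a∉core with T-∨-elim (δ c a) c≡a∨a∉core
      ... | inj₁ c≡a = c≢a (δ⇒≡ c≡a)
      ... | inj₂ a∉core = core∉outside a a∈core a∉core
      included : ∀ v → T (δ a v ∨ (δ c v ∨ outside v)) → T (D v)
      included v v∈ with T-∨-elim (δ a v) v∈
      ... | inj₁ a≡v = subst (λ x → T (D x)) (δ⇒≡ a≡v) Da
      ... | inj₂ v∈′ with T-∨-elim (δ c v) v∈′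
      ...   | inj₁ c≡v = subst (λ x → T (D x)) (δ⇒≡ c≡v) Dc
      ...   | inj₂ v∉core = outside⊆D v v∉core

  domNum-H : DomNum H (2 + (n ∸ m))
  domNum-H = domNum-intro H small-or-outside (2 + (n ∸ m)) small-or-outside-dominates small-or-outside-count lower-bound

  length-E : 2 * length E + m₀ * m ≤ 2 * (n C 2) + (m₀ * m) % 2
  length-E = begin
    2 * length E + m₀ * m
      ≤⟨ +-monoʳ-≤ (2 * length E) (≤-trans edgeCount-H (+-monoʳ-≤ (edgeCount H) (⟦odd⟧≤[n*[2+n]]%2 m₀))) ⟩
    2 * length E + (edgeCount H + (m₀ * m) % 2)
      ≡⟨ regroup (2 * length E) (edgeCount H) ((m₀ * m) % 2) ⟩
    edgeCount H + 2 * length E + (m₀ * m) % 2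
      ≡⟨ cong (_+ (m₀ * m) % 2) (edgeCount-delete (K n) E edges-isEdgeSet) ⟨
    edgeCount (K n) + (m₀ * m) % 2
      ≡⟨ cong (_+ (m₀ * m) % 2) (trans (edgeCount-K n) (sym (2*nC2 n))) ⟩
    2 * (n C 2) + (m₀ * m) % 2 ∎
    where
    open ≤-Reasoning
    regroup : ∀ a b c → a + (b + c) ≡ b + a + c
    regroup = solve-∀

2+[n∸1]≡n+1 : ∀ {n} → 1 ≤ n → 2 + (n ∸ 1) ≡ n + 1
2+[n∸1]≡n+1 {suc n} _ = cong suc (+-comm 1 n)

sb-upper : ∀ n k → 1 ≤ k → k + 1 ≤ n → Σ (List (Fin n × Fin n)) λ E →
           Bondage (K n) k E × 2 * length E + (n ∸ k ∸ 1) * (n ∸ k + 1) ≤ 2 * (n C 2) + ((n ∸ k ∸ 1) * (n ∸ k + 1)) % 2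
sb-upper n k 1≤k k+1≤n =
  E , (edges-isEdgeSet , 1 , domNum-K n zero′ , subst (DomNum H) γ-size domNum-H) ,
  subst (λ x → 2 * length E + x ≤ 2 * (n C 2) + x % 2) (cong (m₀ *_) m≡d+1) length-E
  where
  d m₀ : ℕ
  d = n ∸ k
  m₀ = d ∸ 1
  1≤d : 1 ≤ d
  1≤d = m+n≤o⇒m≤o∸n 1 (subst (_≤ n) (+-comm k 1) k+1≤n)
  d+k≡n : d + k ≡ n
  d+k≡n = m∸n+n≡m (≤-trans (m≤m+n k 1) k+1≤n)
  m≡d+1 : 2 + m₀ ≡ d + 1
  m≡d+1 = 2+[n∸1]≡n+1 1≤d
  m≤n : 2 + m₀ ≤ n
  m≤n = subst₂ _≤_ (sym m≡d+1) d+k≡n (+-monoʳ-≤ d 1≤k)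
  open Construction n m₀ m≤n
  γ-size : 2 + (n ∸ (2 + m₀)) ≡ 1 + k
  γ-size = begin
    2 + (n ∸ (2 + m₀))    ≡⟨ cong₂ (λ a b → 2 + (a ∸ b)) (sym d+k≡n) m≡d+1 ⟩
    2 + (d + k ∸ (d + 1)) ≡⟨ cong (2 +_) ([m+n]∸[m+o]≡n∸o d k 1) ⟩
    2 + (k ∸ 1)           ≡⟨ trans (2+[n∸1]≡n+1 1≤k) (+-comm k 1) ⟩
    1 + k                 ∎
    where open ≡-Reasoning

corollary3 : ∀ (n k : ℕ) → 1 ≤ k → n ≥ k + 1 →
    SbNum (K n) k ((n C 2) ∸ (((n ∸ k ∸ 1) * (n ∸ k + 1)) / 2))
corollary3 n k 1≤k k+1≤n =
  (E , E-bondage , ≤-antisym (o≤m∸n/2 (n C 2) X (length E) E-small) (sb-lower n k k+1≤n E E-bondage)) ,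
  sb-lower n k k+1≤n
  where
  X : ℕ
  X = (n ∸ k ∸ 1) * (n ∸ k + 1)
  upper : Σ (List (Fin n × Fin n)) λ E → Bondage (K n) k E × 2 * length E + X ≤ 2 * (n C 2) + X % 2
  upper = sb-upper n k 1≤k k+1≤n
  E : List (Fin n × Fin n)
  E = proj₁ upper
  E-bondage : Bondage (K n) k E
  E-bondage = proj₁ (proj₂ upper)
  E-small : 2 * length E + X ≤ 2 * (n C 2) + X % 2
  E-small = proj₂ (proj₂ upper)
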